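{- Let $C,\ell$ be integers with $\ell>C$, and let $i\in[C]\cap[k]$. For $x,y\in\{0,1\}^k$, if $\mathscr{D}_{2,\ell}(x)=\mathscr{D}_{2,\ell}(y)$ then $x(i)+x'(i)=y(i)+y'(i)$.
   Context: A binary string $x\in\{0,1\}^k$ is a function $x:[k]\to\{0,1\}$; its reversal is $x'(i)=x(k-i+1)$. For finite nonempty $S\subset\mathbb{Z}$ with elements $S_1<\dots<S_{|S|}$ and $S\subseteq[k]$, $x|_S$ is the string $i\mapsto x(S_i)$. The $S$-deck $D_S(x)$ is the multiset of strings $g$ of length $|S|$ in which $g$ has multiplicity $\sum_{i\in\mathbb{Z}}\big(I(i+S\subseteq[k],\ x|_{i+S}=g)+I(i+S\subseteq[k],\ x'|_{i+S}=g)\big)$. The width is $\Delta(S)=\max S-\min S+1$. $\mathscr{D}_{s,\ell}(x)$ is the map sending each finite nonempty $S\subset\mathbb{Z}$ with $\Delta(S)\le\ell$ and $|S|\le s$ to $D_S(x)$. -}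

module Defs where

open import Data.Bool using (Bool; true; false)
import Data.Bool.Properties as BoolP
open import Data.Nat as ℕ using (ℕ; zero; suc)
open import Data.Nat.Properties using (_<?_)
open import Data.Integer as ℤ using (ℤ; +_; -[1+_])
open import Data.Fin using (Fin; fromℕ<)
open import Data.List using (List; []; _∷_; map; upTo; length; filter; last)
import Data.List.Properties as ListP
open import Data.List.Relation.Unary.Linked using (Linked)
open import Data.Maybe using (Maybe; just; nothing; fromMaybe)
import Data.Maybe.Properties as MaybeP
open import Data.Vec using (Vec; lookup; reverse; toList)
open import Relation.Nullary using (yes; no)
open import Relation.Binary.PropositionalEquality using (_≡_)

-- A binary string x ∈ {0,1}^k is a Vec Bool k; position j ∈ [k] = {1..k}
-- corresponds to the Fin index j-1.

bit : Bool → ℕ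
bit false = 0
bit true  = 1

at : ∀ {k} → Vec Bool k → ℤ → Maybe Bool
at {k} x (+ zero)    = nothing
at {k} x (+ suc n) with n <? k
... | yes p = just (lookup x (fromℕ< p))
... | no _  = nothing
at {k} x -[1+ _ ]    = nothing

restrict : ∀ {k} → Vec Bool k → List ℤ → Maybe (List Bool)
restrict x [] = just []
restrict x (j ∷ T) with at x j | restrict x T
... | just b | just bs = just (b ∷ bs)
... | _      | _       = nothing

-- A finite nonempty set S ⊂ ℤ, represented by its elements listed in
-- strictly increasing order S₁ < S₂ < … (min S = S₁).
record FinSetℤ : Set where
  constructor mkSet
  field
    minElt  : ℤ
    rest    : List ℤ
    sorted  : Linked ℤ._<_ (minElt ∷ rest)

open FinSetℤ public

elems : FinSetℤ → List ℤ
elems S = minElt S ∷ rest S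

card : FinSetℤ → ℕ
card S = length (elems S)

maxElt : FinSetℤ → ℤ
maxElt S = fromMaybe (minElt S) (last (rest S))

width : FinSetℤ → ℤ
width S = (maxElt S ℤ.- minElt S) ℤ.+ ℤ.1ℤ

shift : ℤ → FinSetℤ → List ℤ
shift i S = map (λ j → i ℤ.+ j) (elems S)

-- All shifts i ∈ ℤ with 1 - min S ≤ i ≤ k - min S.  Every i with
-- i + S ⊆ [k] lies in this range, so summing the indicators over this
-- range equals the sum over all i ∈ ℤ.
shifts : ℕ → FinSetℤ → List ℤ
shifts k S = map (λ n → (+ n) ℤ.+ (ℤ.1ℤ ℤ.- minElt S)) (upTo k)

occ : ∀ {k} → FinSetℤ → Vec Bool k → List Bool → ℕ
occ {k} S x g =
  length (filter (λ i → MaybeP.≡-dec (ListP.≡-dec BoolP._≟_)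
                          (restrict x (shift i S)) (just g))
                 (shifts k S))

deckMult : ∀ {k} → FinSetℤ → Vec Bool k → List Bool → ℕ
deckMult S x g = occ S x g ℕ.+ occ S (reverse x) g

SameDeck : ∀ {k} → FinSetℤ → Vec Bool k → Vec Bool k → Set
SameDeck S x y = (g : Vec Bool (card S)) → deckMult S x (toList g) ≡ deckMult S y (toList g)

SameDecks : ∀ {k} → ℕ → ℤ → Vec Bool k → Vec Bool k → Set
SameDecks s ℓ x y =
  (S : FinSetℤ) → width S ℤ.≤ ℓ → card S ℕ.≤ s → SameDeck S x y

-- For the gap set {0, m} (just {0} when m = 0), the strings of the deck that begin
-- with 1 count the 1s among the first k − m positions of x and of its reversal x′.
-- So the decks of width at most ℓ determine M(m) = #1s in x[1..k−m] + #1s in x′[1..k−m]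
-- for every m < ℓ, and M(m) − M(m+1) = x(k−m) + x′(k−m) = x′(m+1) + x(m+1).
-- Taking m = i − 1, both gap sets {0, i − 1} and {0, i} have width at most C + 1 ≤ ℓ.
module Submission where

open import Defs
open import Data.Bool using (Bool; true; false)
import Data.Bool.Properties as BoolP
open import Data.Nat as ℕ using (ℕ; zero; suc; _+_; _*_; _∸_; z≤n; s≤s)
open import Data.Nat.Properties
open import Data.Nat.ListAction using (sum)
open import Data.Nat.ListAction.Properties using (sum-++)
open import Data.Integer as ℤ using (ℤ; +_; +≤+; +<+)
import Data.Integer.Properties as ℤP
open import Data.Fin as Fin using (Fin; toℕ; fromℕ<; fromℕ; inject₁; opposite)
import Data.Fin.Properties as FinP
open import Data.List as List using (List; []; _∷_; map; upTo; length; filter)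
import Data.List.Properties as ListP
open import Data.List.Relation.Unary.Linked using ([-]; _∷_)
open import Data.Maybe using (Maybe; just; nothing; maybe; is-just; zipWith)
import Data.Maybe.Properties as MaybeP
open import Data.Vec as Vec using (Vec; lookup; reverse; _∷ʳ_)
import Data.Vec.Properties as VecP
open import Data.Sum using (inj₁; inj₂)
open import Function using (_∘_)
open import Relation.Nullary using (does; yes; no; contradiction)
open import Relation.Unary using (Decidable)
open import Relation.Binary.PropositionalEquality
open import Algebra.Properties.CommutativeSemigroup +-commutativeSemigroup using (interchange)

open ≡-Reasoning

private
  variable
    A : Set
    k : ℕ

length-filter≡sum : ∀ {P : A → Set} (P? : Decidable P) (xs : List A) →
  length (filter P? xs) ≡ sum (map (bit ∘ does ∘ P?) xs)
length-filter≡sum P? [] = refl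
length-filter≡sum P? (a ∷ xs) with does (P? a)
... | true  = cong suc (length-filter≡sum P? xs)
... | false = length-filter≡sum P? xs

sum-map-+ : ∀ (f g : A → ℕ) xs → sum (map (λ a → f a + g a) xs) ≡ sum (map f xs) + sum (map g xs)
sum-map-+ f g [] = refl
sum-map-+ f g (a ∷ xs) = begin
  (f a + g a) + sum (map (λ a → f a + g a) xs)     ≡⟨ cong (_+_ (f a + g a)) (sum-map-+ f g xs) ⟩
  (f a + g a) + (sum (map f xs) + sum (map g xs))  ≡⟨ interchange (f a) (g a) _ _ ⟩
  (f a + sum (map f xs)) + (g a + sum (map g xs))  ∎

sum-upTo-suc : ∀ (f : ℕ → ℕ) n → sum (map f (upTo (suc n))) ≡ sum (map f (upTo n)) + f n
sum-upTo-suc f n = begin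
  sum (map f (upTo (suc n)))                ≡⟨ cong (sum ∘ map f) (ListP.upTo-∷ʳ n) ⟨
  sum (map f (upTo n List.++ n ∷ []))       ≡⟨ cong sum (ListP.map-++ f (upTo n) (n ∷ [])) ⟩
  sum (map f (upTo n) List.++ f n ∷ [])     ≡⟨ sum-++ (map f (upTo n)) (f n ∷ []) ⟩
  sum (map f (upTo n)) + (f n + 0)          ≡⟨ cong (_+_ (sum (map f (upTo n)))) (+-identityʳ (f n)) ⟩
  sum (map f (upTo n)) + f n                ∎

sum-upTo-cong : ∀ {f g : ℕ → ℕ} n → (∀ j → j ℕ.< n → f j ≡ g j) →
  sum (map f (upTo n)) ≡ sum (map g (upTo n))
sum-upTo-cong zero f≡g = refl
sum-upTo-cong {f} {g} (suc n) f≡g = begin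
  sum (map f (upTo (suc n)))   ≡⟨ sum-upTo-suc f n ⟩
  sum (map f (upTo n)) + f n   ≡⟨ cong₂ _+_ (sum-upTo-cong n (λ j j<n → f≡g j (m<n⇒m<1+n j<n))) (f≡g n ≤-refl) ⟩
  sum (map g (upTo n)) + g n   ≡⟨ sum-upTo-suc g n ⟨
  sum (map g (upTo (suc n)))   ∎

sum-upTo-vanishing : ∀ (f : ℕ → ℕ) {m n} → m ℕ.≤ n → (∀ j → m ℕ.≤ j → j ℕ.< n → f j ≡ 0) →
  sum (map f (upTo n)) ≡ sum (map f (upTo m))
sum-upTo-vanishing f {n = zero} z≤n f≡0 = refl
sum-upTo-vanishing f {m} {suc n} m≤1+n f≡0 with m≤n⇒m<n∨m≡n m≤1+n
... | inj₂ refl = refl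
... | inj₁ (s≤s m≤n) = begin
  sum (map f (upTo (suc n)))   ≡⟨ sum-upTo-suc f n ⟩
  sum (map f (upTo n)) + f n
    ≡⟨ cong₂ _+_ (sum-upTo-vanishing f m≤n (λ j m≤j j<n → f≡0 j m≤j (m<n⇒m<1+n j<n))) (f≡0 n m≤n ≤-refl) ⟩
  sum (map f (upTo m)) + 0     ≡⟨ +-identityʳ _ ⟩
  sum (map f (upTo m))         ∎

m<o∸n⇒m+n<o : ∀ m n {o} → m ℕ.< o ∸ n → m + n ℕ.< o
m<o∸n⇒m+n<o m zero    {o}     m<o = subst (ℕ._< o) (sym (+-identityʳ m)) m<o
m<o∸n⇒m+n<o m (suc n) {zero}  ()
m<o∸n⇒m+n<o m (suc n) {suc o} m<o∸n = subst (ℕ._< suc o) (sym (+-suc m n)) (s≤s (m<o∸n⇒m+n<o m n m<o∸n))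

m∸n≤o⇒m≤o+n : ∀ m n {o} → m ∸ n ℕ.≤ o → m ℕ.≤ o + n
m∸n≤o⇒m≤o+n m n {o} m∸n≤o =
  ≤-trans (m≤n+m∸n m n) (subst (n + (m ∸ n) ℕ.≤_) (+-comm n o) (+-monoʳ-≤ n m∸n≤o))

lookup-∷ʳ-fromℕ : ∀ (xs : Vec A k) a → lookup (xs ∷ʳ a) (fromℕ k) ≡ a
lookup-∷ʳ-fromℕ Vec.[] a = refl
lookup-∷ʳ-fromℕ (b Vec.∷ xs) a = lookup-∷ʳ-fromℕ xs a

lookup-∷ʳ-inject₁ : ∀ (xs : Vec A k) a i → lookup (xs ∷ʳ a) (inject₁ i) ≡ lookup xs i
lookup-∷ʳ-inject₁ (b Vec.∷ xs) a Fin.zero = refl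
lookup-∷ʳ-inject₁ (b Vec.∷ xs) a (Fin.suc i) = lookup-∷ʳ-inject₁ xs a i

lookup-reverse-opposite : ∀ (xs : Vec A k) i → lookup (reverse xs) (opposite i) ≡ lookup xs i
lookup-reverse-opposite (a Vec.∷ xs) i rewrite VecP.reverse-∷ a xs with i
... | Fin.zero  = lookup-∷ʳ-fromℕ (reverse xs) a
... | Fin.suc j = trans (lookup-∷ʳ-inject₁ (reverse xs) a (opposite j)) (lookup-reverse-opposite xs j)

at-suc-< : ∀ (x : Vec Bool k) {n} (n<k : n ℕ.< k) → at x (+ suc n) ≡ just (lookup x (fromℕ< n<k))
at-suc-< {k} x {n} n<k with n <? k
... | yes n<k′ = cong (λ p → just (lookup x (fromℕ< p))) (<-irrelevant n<k′ n<k)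
... | no n≮k  = contradiction n<k n≮k

at-suc-≥ : ∀ (x : Vec Bool k) {n} → k ℕ.≤ n → at x (+ suc n) ≡ nothing
at-suc-≥ {k} x {n} k≤n with n <? k
... | yes n<k = contradiction n<k (≤⇒≯ k≤n)
... | no _    = refl

at-suc-toℕ : ∀ (x : Vec Bool k) i → at x (+ suc (toℕ i)) ≡ just (lookup x i)
at-suc-toℕ x i = trans (at-suc-< x (FinP.toℕ<n i)) (cong (just ∘ lookup x) (FinP.fromℕ<-toℕ i _))

restrict-∷ : ∀ (x : Vec Bool k) j T → restrict x (j ∷ T) ≡ zipWith _∷_ (at x j) (restrict x T)
restrict-∷ x j T with at x j | restrict x T
... | just b  | just bs = refl
... | just b  | nothing = refl
... | nothing | _       = refl

gapSet : ℕ → FinSetℤ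
gapSet zero    = mkSet (+ 0) [] [-]
gapSet (suc m) = mkSet (+ 0) (+ suc m ∷ []) (+<+ (s≤s z≤n) ∷ [-])

width-gapSet : ∀ m → width (gapSet m) ≡ + suc m
width-gapSet zero    = refl
width-gapSet (suc m) = cong (+_ ∘ suc) (trans (cong (_+ 1) (+-identityʳ m)) (+-comm m 1))

card-gapSet : ∀ m → card (gapSet m) ℕ.≤ 2
card-gapSet zero    = s≤s z≤n
card-gapSet (suc m) = ≤-refl

matches : Maybe (List Bool) → List Bool → ℕ
matches r g = bit (does (MaybeP.≡-dec (ListP.≡-dec BoolP._≟_) r (just g)))

occ≡sum-matches : ∀ S (x : Vec Bool k) g →
  occ S x g ≡ sum (map (λ n → matches (restrict x (shift (+ n ℤ.+ (ℤ.1ℤ ℤ.- minElt S)) S)) g) (upTo k))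
occ≡sum-matches {k} S x g = trans (length-filter≡sum _ (map _ (upTo k))) (cong sum (sym (ListP.map-∘ (upTo k))))

oneAt : Vec Bool k → ℕ → ℕ
oneAt x n = maybe bit 0 (at x (+ suc n))

prefixOnes : Vec Bool k → ℕ → ℕ
prefixOnes x n = sum (map (oneAt x) (upTo n))

leadingOnes : ℕ → Vec Bool k → ℕ
leadingOnes zero    x = occ (gapSet zero) x (true ∷ [])
leadingOnes (suc m) x = occ (gapSet (suc m)) x (true ∷ true ∷ []) + occ (gapSet (suc m)) x (true ∷ false ∷ [])

matches-leadingOne₁ : ∀ a → matches (zipWith _∷_ a (just [])) (true ∷ []) ≡ maybe bit 0 a
matches-leadingOne₁ (just true)  = refl
matches-leadingOne₁ (just false) = refl
matches-leadingOne₁ nothing      = refl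

matches-leadingOne₂ : ∀ a b → let r = zipWith _∷_ a (zipWith _∷_ b (just [])) in
  matches r (true ∷ true ∷ []) + matches r (true ∷ false ∷ []) ≡ maybe bit 0 a * bit (is-just b)
matches-leadingOne₂ (just true)  (just true)  = refl
matches-leadingOne₂ (just true)  (just false) = refl
matches-leadingOne₂ (just true)  nothing      = refl
matches-leadingOne₂ (just false) (just _)     = refl
matches-leadingOne₂ (just false) nothing      = refl
matches-leadingOne₂ nothing      _            = refl

restrict-window₀ : ∀ (x : Vec Bool k) n →
  restrict x (shift (+ n ℤ.+ (ℤ.1ℤ ℤ.- + 0)) (gapSet zero)) ≡ zipWith _∷_ (at x (+ suc n)) (just [])
restrict-window₀ x n = begin
  restrict x (+ (n + 1 + 0) ∷ [])  ≡⟨ cong (λ j → restrict x (+ j ∷ [])) (trans (+-identityʳ (n + 1)) (+-comm n 1)) ⟩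
  restrict x (+ suc n ∷ [])        ≡⟨ restrict-∷ x (+ suc n) [] ⟩
  zipWith _∷_ (at x (+ suc n)) (just []) ∎

restrict-window : ∀ (x : Vec Bool k) m n →
  restrict x (shift (+ n ℤ.+ (ℤ.1ℤ ℤ.- + 0)) (gapSet (suc m)))
    ≡ zipWith _∷_ (at x (+ suc n)) (zipWith _∷_ (at x (+ suc (n + suc m))) (just []))
restrict-window x m n = begin
  restrict x (+ (n + 1 + 0) ∷ + (n + 1 + suc m) ∷ [])
    ≡⟨ cong₂ (λ i j → restrict x (+ i ∷ + j ∷ [])) (trans (+-identityʳ (n + 1)) n+1≡1+n) (cong (_+ suc m) n+1≡1+n) ⟩
  restrict x (+ suc n ∷ + suc (n + suc m) ∷ [])
    ≡⟨ restrict-∷ x (+ suc n) (+ suc (n + suc m) ∷ []) ⟩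
  zipWith _∷_ (at x (+ suc n)) (restrict x (+ suc (n + suc m) ∷ []))
    ≡⟨ cong (zipWith _∷_ (at x (+ suc n))) (restrict-∷ x (+ suc (n + suc m)) []) ⟩
  zipWith _∷_ (at x (+ suc n)) (zipWith _∷_ (at x (+ suc (n + suc m))) (just [])) ∎
  where
  n+1≡1+n : n + 1 ≡ suc n
  n+1≡1+n = +-comm n 1

leadingOnes≡prefixOnes : ∀ m (x : Vec Bool k) → leadingOnes m x ≡ prefixOnes x (k ∸ m)
leadingOnes≡prefixOnes {k} zero x =
  trans (occ≡sum-matches (gapSet zero) x (true ∷ [])) (cong sum (ListP.map-cong window (upTo k)))
  where
  window : ∀ n → matches (restrict x (shift (+ n ℤ.+ (ℤ.1ℤ ℤ.- + 0)) (gapSet zero))) (true ∷ []) ≡ oneAt x n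
  window n = trans (cong (λ r → matches r (true ∷ [])) (restrict-window₀ x n)) (matches-leadingOne₁ (at x (+ suc n)))
leadingOnes≡prefixOnes {k} (suc m) x = begin
  leadingOnes (suc m) x
    ≡⟨ cong₂ _+_ (occ≡sum-matches S x (true ∷ true ∷ [])) (occ≡sum-matches S x (true ∷ false ∷ [])) ⟩
  sum (map (windowMatch (true ∷ true ∷ [])) (upTo k)) + sum (map (windowMatch (true ∷ false ∷ [])) (upTo k))
    ≡⟨ sum-map-+ _ _ (upTo k) ⟨
  sum (map (λ n → windowMatch (true ∷ true ∷ []) n + windowMatch (true ∷ false ∷ []) n) (upTo k))
    ≡⟨ cong sum (ListP.map-cong window (upTo k)) ⟩
  sum (map onePair (upTo k))
    ≡⟨ sum-upTo-vanishing onePair (m∸n≤m k (suc m)) beyond ⟩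
  sum (map onePair (upTo (k ∸ suc m)))
    ≡⟨ sum-upTo-cong (k ∸ suc m) within ⟩
  prefixOnes x (k ∸ suc m) ∎
  where
  S : FinSetℤ
  S = gapSet (suc m)

  windowMatch : List Bool → ℕ → ℕ
  windowMatch g n = matches (restrict x (shift (+ n ℤ.+ (ℤ.1ℤ ℤ.- + 0)) S)) g

  onePair : ℕ → ℕ
  onePair n = oneAt x n * bit (is-just (at x (+ suc (n + suc m))))

  window : ∀ n → windowMatch (true ∷ true ∷ []) n + windowMatch (true ∷ false ∷ []) n ≡ onePair n
  window n rewrite restrict-window x m n = matches-leadingOne₂ (at x (+ suc n)) (at x (+ suc (n + suc m)))

  beyond : ∀ n → k ∸ suc m ℕ.≤ n → n ℕ.< k → onePair n ≡ 0
  beyond n k∸1+m≤n _ rewrite at-suc-≥ x (m∸n≤o⇒m≤o+n k (suc m) k∸1+m≤n) = *-zeroʳ (oneAt x n)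

  within : ∀ n → n ℕ.< k ∸ suc m → onePair n ≡ oneAt x n
  within n n<k∸1+m rewrite at-suc-< x (m<o∸n⇒m+n<o n (suc m) n<k∸1+m) = *-identityʳ (oneAt x n)

prefixOnes-step : ∀ (x : Vec Bool k) {m} → m ℕ.< k →
  prefixOnes x (k ∸ m) ≡ prefixOnes x (k ∸ suc m) + oneAt x (k ∸ suc m)
prefixOnes-step {k} x {m} m<k = begin
  prefixOnes x (k ∸ m)                            ≡⟨ cong (prefixOnes x) (+-∸-assoc 1 m<k) ⟩
  prefixOnes x (suc (k ∸ suc m))                  ≡⟨ sum-upTo-suc (oneAt x) (k ∸ suc m) ⟩
  prefixOnes x (k ∸ suc m) + oneAt x (k ∸ suc m)  ∎

oneAt-opposite : ∀ (x : Vec Bool k) i → oneAt x (k ∸ suc (toℕ i)) ≡ bit (lookup (reverse x) i)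
oneAt-opposite {k} x i = begin
  oneAt x (k ∸ suc (toℕ i))                        ≡⟨ cong (oneAt x) (FinP.opposite-prop i) ⟨
  oneAt x (toℕ (opposite i))                       ≡⟨ cong (maybe bit 0) (at-suc-toℕ x (opposite i)) ⟩
  bit (lookup x (opposite i))                      ≡⟨ cong (λ z → bit (lookup z (opposite i))) (VecP.reverse-involutive x) ⟨
  bit (lookup (reverse (reverse x)) (opposite i))  ≡⟨ cong bit (lookup-reverse-opposite (reverse x) i) ⟩
  bit (lookup (reverse x) i)                       ∎

leadingOneMult : ℕ → Vec Bool k → ℕ
leadingOneMult m x = leadingOnes m x + leadingOnes m (reverse x)

leadingOneMult-step : ∀ (x : Vec Bool k) i →
  leadingOneMult (toℕ i) x ≡ leadingOneMult (suc (toℕ i)) x + (bit (lookup x i) + bit (lookup (reverse x) i))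
leadingOneMult-step {k} x i = begin
  leadingOneMult m x
    ≡⟨ cong₂ _+_ (leadingOnes≡prefixOnes m x) (leadingOnes≡prefixOnes m x′) ⟩
  prefixOnes x (k ∸ m) + prefixOnes x′ (k ∸ m)
    ≡⟨ cong₂ _+_ (prefixOnes-step x m<k) (prefixOnes-step x′ m<k) ⟩
  (prefixOnes x j + oneAt x j) + (prefixOnes x′ j + oneAt x′ j)
    ≡⟨ interchange (prefixOnes x j) (oneAt x j) (prefixOnes x′ j) (oneAt x′ j) ⟩
  (prefixOnes x j + prefixOnes x′ j) + (oneAt x j + oneAt x′ j)
    ≡⟨ cong₂ _+_ (cong₂ _+_ (leadingOnes≡prefixOnes (suc m) x) (leadingOnes≡prefixOnes (suc m) x′))
                 ends≡oneAts ⟨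
  leadingOneMult (suc m) x + (bit (lookup x i) + bit (lookup x′ i)) ∎
  where
  m j : ℕ
  m = toℕ i
  j = k ∸ suc m

  x′ : Vec Bool k
  x′ = reverse x

  m<k : m ℕ.< k
  m<k = FinP.toℕ<n i

  ends≡oneAts : bit (lookup x i) + bit (lookup x′ i) ≡ oneAt x j + oneAt x′ j
  ends≡oneAts = begin
    bit (lookup x i) + bit (lookup x′ i)            ≡⟨ +-comm (bit (lookup x i)) (bit (lookup x′ i)) ⟩
    bit (lookup x′ i) + bit (lookup x i)            ≡⟨ cong (λ z → bit (lookup x′ i) + bit (lookup z i)) (VecP.reverse-involutive x) ⟨
    bit (lookup x′ i) + bit (lookup (reverse x′) i) ≡⟨ cong₂ _+_ (oneAt-opposite x i) (oneAt-opposite x′ i) ⟨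
    oneAt x j + oneAt x′ j                          ∎

sameDeck⇒leadingOneMult≡ : ∀ m (x y : Vec Bool k) → SameDeck (gapSet m) x y → leadingOneMult m x ≡ leadingOneMult m y
sameDeck⇒leadingOneMult≡ zero    x y same = same (true Vec.∷ Vec.[])
sameDeck⇒leadingOneMult≡ (suc m) x y same = begin
  leadingOneMult (suc m) x                  ≡⟨ regroup x ⟩
  deckMult S x (oneThen true) + deckMult S x (oneThen false)
    ≡⟨ cong₂ _+_ (same (true Vec.∷ true Vec.∷ Vec.[])) (same (true Vec.∷ false Vec.∷ Vec.[])) ⟩
  deckMult S y (oneThen true) + deckMult S y (oneThen false)  ≡⟨ regroup y ⟨
  leadingOneMult (suc m) y                  ∎
  where
  S : FinSetℤ
  S = gapSet (suc m)

  oneThen : Bool → List Bool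
  oneThen b = true ∷ b ∷ []

  regroup : ∀ z → leadingOneMult (suc m) z ≡ deckMult S z (oneThen true) + deckMult S z (oneThen false)
  regroup z = interchange (occ S z (oneThen true)) (occ S z (oneThen false))
                          (occ S (reverse z) (oneThen true)) (occ S (reverse z) (oneThen false))

sameDecks⇒leadingOneMult≡ : ∀ {ℓ} m (x y : Vec Bool k) → SameDecks 2 ℓ x y → + suc m ℤ.≤ ℓ →
  leadingOneMult m x ≡ leadingOneMult m y
sameDecks⇒leadingOneMult≡ m x y same 1+m≤ℓ =
  sameDeck⇒leadingOneMult≡ m x y (same (gapSet m) (subst (ℤ._≤ _) (sym (width-gapSet m)) 1+m≤ℓ) (card-gapSet m))

+<⇒+suc≤ : ∀ {n j} → + n ℤ.< j → + suc n ℤ.≤ j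
+<⇒+suc≤ (+<+ n<j) = +≤+ n<j

corollary5p3 : (k : ℕ) (C ℓ : ℤ) → C ℤ.< ℓ → (i : Fin k) → + (toℕ i + 1) ℤ.≤ C →
    (x y : Vec Bool k) → SameDecks 2 ℓ x y →
    bit (lookup x i) + bit (lookup (reverse x) i) ≡ bit (lookup y i) + bit (lookup (reverse y) i)
corollary5p3 k C ℓ C<ℓ i i+1≤C x y same =
  +-cancelˡ-≡ (leadingOneMult (suc m) y) (ends x) (ends y) (begin
    leadingOneMult (suc m) y + ends x  ≡⟨ cong (_+ ends x) (sameDecks⇒leadingOneMult≡ (suc m) x y same (+<⇒+suc≤ 1+m<ℓ)) ⟨
    leadingOneMult (suc m) x + ends x  ≡⟨ leadingOneMult-step x i ⟨
    leadingOneMult m x                 ≡⟨ sameDecks⇒leadingOneMult≡ m x y same (ℤP.<⇒≤ 1+m<ℓ) ⟩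
    leadingOneMult m y                 ≡⟨ leadingOneMult-step y i ⟩
    leadingOneMult (suc m) y + ends y  ∎)
  where
  m : ℕ
  m = toℕ i

  ends : Vec Bool k → ℕ
  ends z = bit (lookup z i) + bit (lookup (reverse z) i)

  1+m<ℓ : + suc m ℤ.< ℓ
  1+m<ℓ = ℤP.≤-<-trans (subst (λ n → + n ℤ.≤ C) (+-comm m 1) i+1≤C) C<ℓ
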